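{- Let $n$ be a practical number, let $p$ be a prime with $\gcd(n,p)=1$, and let $l$ be a positive integer. Then: (i) If $\sigma(n)$ is even, then $np^l$ is a Zumkeller number. (ii) If $\sigma(n)$ is odd, then $np^l$ is a Zumkeller number if and only if $p\le \sigma(n)$ and $l$ is odd.
   Context: $\sigma(n)$ denotes the sum of all positive divisors of $n$. A positive integer $n$ is a Zumkeller number if the set of all positive divisors of $n$ can be partitioned into two disjoint parts whose sums are equal. A positive integer $n$ is a practical number if every positive integer less than $n$ can be written as a sum of distinct positive divisors of $n$. -}

module Defs where

open import Data.Nat using (ℕ; suc; _<_)
open import Data.Nat.Divisibility using (_∣?_; _∣_)
open import Relation.Nullary using (¬_)
open import Data.List using (List; filter; upTo; _++_; drop)
open import Data.Nat.ListAction using (sum)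
open import Data.List.Relation.Binary.Sublist.Propositional using (_⊆_)
open import Data.List.Relation.Binary.Permutation.Propositional using (_↭_)
open import Data.Product using (Σ; ∃; ∃-syntax; _×_)
open import Relation.Binary.PropositionalEquality using (_≡_)

-- The list of positive divisors of n, in increasing order, without repetition
-- (for n ≥ 1; candidates 1..n, since 0 ∣ n only when n = 0).
divisors : ℕ → List ℕ
divisors n = filter (_∣? n) (drop 1 (upTo (suc n)))

σ : ℕ → ℕ
σ n = sum (divisors n)

-- n is Zumkeller: the divisors of n can be split into two disjoint parts
-- (A and B together are a rearrangement of the divisor list) with equal sums.
Zumkeller : ℕ → Set
Zumkeller n = ∃[ A ] ∃[ B ] ((A ++ B) ↭ divisors n × sum A ≡ sum B)

-- n is practical: every positive integer m < n is a sum of distinct positive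
-- divisors of n (a sublist of the duplicate-free divisor list).
Practical : ℕ → Set
Practical n = ∀ m → 0 < m → m < n → ∃[ S ] (S ⊆ divisors n × sum S ≡ m)

Even : ℕ → Set
Even m = 2 ∣ m

Odd : ℕ → Set
Odd m = ¬ (2 ∣ m)

module Submission where

-- Let D be the divisor list of n and p a prime not dividing n.  The divisors
-- of n·p^i are the entries of the "layer list" L i, where L 0 = D and
-- L (i+1) = D ++ p·L i, each occurring once; hence σ(n·p^i) = σ(n)·G i with
-- G i = 1 + p + ... + p^i.  Call t a subsum of a list if the list splits into
-- a part summing to t and the rest; N is Zumkeller iff σ(N)/2 is a subsum of
-- its divisors, and subsums c of D and t of L i give the subsum c + p·t of
-- L (i+1).  The one input from practicality is completeness: every m ≤ σ(n)
-- is a subsum of D, because each divisor exceeds the sum of the smaller ones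
-- by at most one.
--   (i)   If σ(n) = 2h, take h on every level: h·G l is half of σ(n)·G l.
--   (ii)⇐ p is odd (practical numbers > 1 are even).  With s₁ = (σ(n) - p)/2
--         and s₂ = (σ(n) + 1)/2, 2(s₁ + p·s₂) = σ(n)(1 + p); alternating s₁
--         and s₂ over the levels gives half of σ(n)·G l for odd l.
--   (ii)⇒ σ(n)·G l is even, but G l is odd for even l; and if σ(n) < p, the
--         entries prime to p in the two halves are the divisors of n, their
--         sums are congruent modulo p and below p, hence equal, so σ(n) would
--         be even.

open import Defs
open import Data.Nat using (ℕ; zero; suc; _+_; _*_; _∸_; _^_; _<_; _≤_; z≤n; s≤s; NonZero; >-nonZero; >-nonZero⁻¹; _≤?_; _%_)
open import Data.Nat.Properties
open import Data.Nat.Divisibility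
  using (_∣_; divides; _∣?_; ∣⇒≤; ∣-refl; ∣-trans; ∣1⇒≡1; ∣m+n∣m⇒∣n; m∣m*n; n∣m*n; ∣m⇒∣m*n; *-monoʳ-∣; *-cancelʳ-∣)
open import Data.Nat.DivMod using ([m+kn]%n≡m%n; m<n⇒m%n≡m)
open import Data.Nat.GCD using (gcd)
open import Data.Nat.Coprimality using (Coprime; coprime-divisor; gcd≡1⇒coprime)
open import Data.Nat.Primality using (Prime; prime⇒irreducible; prime⇒nonZero; euclidsLemma; prime[2]; ¬prime[1])
open import Data.Nat.Tactic.RingSolver using (solve-∀)
open import Data.Nat.ListAction using (sum)
open import Data.Nat.ListAction.Properties using (sum-++; sum-↭)
open import Data.List using (List; []; _∷_; _++_; map; filter; applyUpTo; [_])
import Data.List.Properties as List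
open import Data.List.Membership.Propositional using (_∈_)
open import Data.List.Membership.Propositional.Properties
  using (∈-filter⁻; ∈-filter⁺; ∈-applyUpTo⁻; ∈-applyUpTo⁺; ∈-++⁻; ∈-++⁺ˡ; ∈-++⁺ʳ; ∈-map⁻; ∈-map⁺)
open import Data.List.Membership.Propositional.Properties.WithK using (unique∧set⇒bag)
open import Data.List.Relation.Unary.All as All using (All)
open import Data.List.Relation.Unary.Any using (here; there)
open import Data.List.Relation.Unary.Unique.Propositional using (Unique)
import Data.List.Relation.Unary.Unique.Propositional.Properties as Unique
open import Data.List.Relation.Binary.Sublist.Propositional using (_⊆_; []; _∷_; _∷ʳ_; lookup)
open import Data.List.Relation.Binary.Sublist.Propositional.Properties using (filter⁺; filter-⊆)
open import Data.List.Relation.Binary.Permutation.Propositional using (_↭_; ↭-refl; ↭-trans; ↭-sym; ↭-reflexive)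
import Data.List.Relation.Binary.Permutation.Propositional.Properties as Perm
open import Data.List.Relation.Binary.BagAndSetEquality using (∼bag⇒↭)
open import Data.Product using (∃-syntax; _×_; _,_; proj₁; proj₂)
open import Data.Sum using (_⊎_; inj₁; inj₂)
open import Data.Empty using (⊥-elim)
open import Function using (_∘_)
open import Function.Bundles using (_⇔_; mk⇔)
open import Relation.Nullary using (¬_; Dec; yes; no; ¬?)
open import Relation.Binary.PropositionalEquality
  using (_≡_; refl; sym; trans; cong; cong₂; subst; subst₂; module ≡-Reasoning)

parity : ∀ m → (∃[ k ] m ≡ k * 2) ⊎ (∃[ k ] m ≡ suc (k * 2))
parity zero = inj₁ (0 , refl)
parity (suc m) with parity m
... | inj₁ (k , refl) = inj₂ (k , refl)
... | inj₂ (k , refl) = inj₁ (suc k , refl)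

double : ∀ t → t + t ≡ t * 2
double t = trans (cong (t +_) (sym (+-identityʳ t))) (*-comm 2 t)

odd-suc-double : ∀ k → ¬ 2 ∣ suc (k * 2)
odd-suc-double k 2∣ with ∣1⇒≡1 (∣m+n∣m⇒∣n (subst (2 ∣_) (+-comm 1 (k * 2)) 2∣) (n∣m*n k))
... | ()

Subsum : List ℕ → ℕ → Set
Subsum L t = ∃[ A ] ∃[ B ] ((A ++ B) ↭ L × sum A ≡ t)

subsum-↭ : ∀ {L M t} → L ↭ M → Subsum L t → Subsum M t
subsum-↭ L↭M (A , B , AB↭L , sA) = A , B , ↭-trans AB↭L L↭M , sA

subsum-≡ : ∀ {L s t} → s ≡ t → Subsum L s → Subsum L t
subsum-≡ refl S = S

subsum-none : ∀ x → Subsum [ x ] 0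
subsum-none x = [] , [ x ] , ↭-refl , refl

subsum-all : ∀ x → Subsum [ x ] x
subsum-all x = [ x ] , [] , ↭-refl , +-identityʳ x

subsum-++ : ∀ {L M s t} → Subsum L s → Subsum M t → Subsum (L ++ M) (s + t)
subsum-++ {L} {M} (A , B , AB↭L , sA) (C , D , CD↭M , sC) =
  A ++ C , B ++ D , regroup , trans (sum-++ A C) (cong₂ _+_ sA sC)
  where
  regroup : (A ++ C) ++ (B ++ D) ↭ L ++ M
  regroup = ↭-trans (↭-reflexive (List.++-assoc A C (B ++ D)))
            (↭-trans (Perm.++⁺ˡ A (Perm.shifts C B))
            (↭-trans (↭-reflexive (sym (List.++-assoc A B (C ++ D))))
            (Perm.++⁺ AB↭L CD↭M)))

sum-scale : ∀ c L → sum (map (c *_) L) ≡ c * sum L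
sum-scale c [] = sym (*-zeroʳ c)
sum-scale c (x ∷ L) = trans (cong (c * x +_) (sum-scale c L)) (sym (*-distribˡ-+ c x (sum L)))

subsum-scale : ∀ {L t} c → Subsum L t → Subsum (map (c *_) L) (c * t)
subsum-scale c (A , B , AB↭L , sA) =
  map (c *_) A , map (c *_) B ,
  ↭-trans (↭-reflexive (sym (List.map-++ (c *_) A B))) (Perm.map⁺ (c *_) AB↭L) ,
  trans (sum-scale c A) (cong (c *_) sA)

zumkeller-from-half : ∀ {N t} → Subsum (divisors N) t → σ N ≡ t * 2 → Zumkeller N
zumkeller-from-half {N} {t} (A , B , AB↭D , sA) σ≡ = A , B , AB↭D , trans sA (sym sB)
  where
  total : t + sum B ≡ t + t
  total = begin
    t + sum B      ≡⟨ cong (_+ sum B) sA ⟨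
    sum A + sum B  ≡⟨ sum-++ A B ⟨
    sum (A ++ B)   ≡⟨ sum-↭ AB↭D ⟩
    σ N            ≡⟨ σ≡ ⟩
    t * 2          ≡⟨ double t ⟨
    t + t          ∎
    where open ≡-Reasoning
  sB : sum B ≡ t
  sB = +-cancelˡ-≡ t (sum B) t total

zumkeller⇒σ-even : ∀ {N} → Zumkeller N → 2 ∣ σ N
zumkeller⇒σ-even {N} (A , B , AB↭D , sA≡sB) = divides (sum A) (begin
  σ N                ≡⟨ sum-↭ AB↭D ⟨
  sum (A ++ B)       ≡⟨ sum-++ A B ⟩
  sum A + sum B      ≡⟨ cong (sum A +_) sA≡sB ⟨
  sum A + sum A      ≡⟨ double (sum A) ⟩
  sum A * 2          ∎)
  where open ≡-Reasoning

sum-⊆ : ∀ {S L} → S ⊆ L → sum S ≤ sum L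
sum-⊆ [] = z≤n
sum-⊆ (y ∷ʳ S⊆L) = ≤-trans (sum-⊆ S⊆L) (m≤n+m _ y)
sum-⊆ {x ∷ _} (refl ∷ S⊆L) = +-monoʳ-≤ x (sum-⊆ S⊆L)

∈⇒≤sum : ∀ {x S} → x ∈ S → x ≤ sum S
∈⇒≤sum {x} {.x ∷ S} (here refl) = m≤m+n x (sum S)
∈⇒≤sum {x} {y ∷ S} (there x∈S) = ≤-trans (∈⇒≤sum x∈S) (m≤n+m _ y)

Complete : List ℕ → Set
Complete L = ∀ m → m ≤ sum L → Subsum L m

complete-[] : Complete []
complete-[] m m≤0 = subsum-≡ (sym (n≤0⇒n≡0 m≤0)) ([] , [] , ↭-refl , refl)

-- Appending an element exceeding the current sum by at most one keeps a
-- list complete: targets above the old sum use the new element.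
complete-snoc : ∀ {L x} → Complete L → x ≤ suc (sum L) → Complete (L ++ [ x ])
complete-snoc {L} {x} complete x≤ m m≤ with m ≤? sum L
... | yes m≤L = subsum-≡ (+-identityʳ m) (subsum-++ (complete m m≤L) (subsum-none x))
... | no m≰L = subsum-≡ (m∸n+n≡m x≤m) (subsum-++ (complete (m ∸ x) rest≤) (subsum-all x))
  where
  x≤m : x ≤ m
  x≤m = ≤-trans x≤ (≰⇒> m≰L)
  m≤L+x : m ≤ sum L + x
  m≤L+x = subst (m ≤_) (trans (sum-++ L [ x ]) (cong (sum L +_) (+-identityʳ x))) m≤
  rest≤ : m ∸ x ≤ sum L
  rest≤ = m≤n+o⇒m∸n≤o m x (subst (m ≤_) (+-comm (sum L) x) m≤L+x)

∈-divisors⁻ : ∀ {m x} → x ∈ divisors m → x ∣ m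
∈-divisors⁻ {m} x∈ = proj₂ (∈-filter⁻ (_∣? m) {xs = applyUpTo suc m} x∈)

∈-divisors⁺ : ∀ {m x} → 0 < m → x ∣ m → x ∈ divisors m
∈-divisors⁺ {suc m} {zero} _ (divides q m≡q*0) with () ← trans m≡q*0 (*-zeroʳ q)
∈-divisors⁺ {suc m} {suc i} _ x∣m =
  ∈-filter⁺ (_∣? suc m) {xs = applyUpTo suc (suc m)} (∈-applyUpTo⁺ suc {i} {suc m} (∣⇒≤ x∣m)) x∣m

divisors-unique : ∀ m → Unique (divisors m)
divisors-unique m = Unique.filter⁺ (_∣? m) (Unique.applyUpTo⁺₁ suc m (λ i<j _ → <⇒≢ i<j ∘ suc-injective))

module DivisorsBelow (n : ℕ) where

  below : ℕ → List ℕ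
  below k = filter (_∣? n) (applyUpTo suc k)

  below-suc : ∀ k → below (suc k) ≡ below k ++ filter (_∣? n) [ suc k ]
  below-suc k = trans (cong (filter (_∣? n)) (sym (List.applyUpTo-∷ʳ suc k)))
                      (List.filter-++ (_∣? n) (applyUpTo suc k) [ suc k ])

  below-≤ : ∀ {x k} → x ∈ below k → x ≤ k
  below-≤ {x} {k} x∈ with ∈-applyUpTo⁻ suc {n = k} (proj₁ (∈-filter⁻ (_∣? n) {xs = applyUpTo suc k} x∈))
  ... | i , i<k , refl = i<k

  below-cut : ∀ k m → k ≤ m → filter (_≤? k) (below m) ≡ below k
  below-cut zero zero z≤n = refl
  below-cut k (suc m) k≤ with m≤n⇒m<n∨m≡n k≤
  ... | inj₂ refl = List.filter-all (_≤? suc m) (All.tabulate below-≤)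
  ... | inj₁ (s≤s k≤m) = begin
      filter (_≤? k) (below (suc m))
        ≡⟨ cong (filter (_≤? k)) (below-suc m) ⟩
      filter (_≤? k) (below m ++ filter (_∣? n) [ suc m ])
        ≡⟨ List.filter-++ (_≤? k) (below m) _ ⟩
      filter (_≤? k) (below m) ++ filter (_≤? k) (filter (_∣? n) [ suc m ])
        ≡⟨ cong₂ _++_ (below-cut k m k≤m) (List.filter-none (_≤? k) (All.tabulate too-big)) ⟩
      below k ++ []
        ≡⟨ List.++-identityʳ (below k) ⟩
      below k ∎
    where
    open ≡-Reasoning
    too-big : ∀ {x} → x ∈ filter (_∣? n) [ suc m ] → ¬ x ≤ k
    too-big x∈ with proj₁ (∈-filter⁻ (_∣? n) {xs = [ suc m ]} x∈)
    ... | here refl = <⇒≱ (s≤s k≤m)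

  small-sublist-sum : ∀ {S k} → k ≤ n → S ⊆ divisors n → All (_≤ k) S → sum S ≤ sum (below k)
  small-sublist-sum {S} {k} k≤n S⊆ S≤k =
    subst₂ (λ X Y → sum X ≤ sum Y) (List.filter-all (_≤? k) S≤k) (below-cut k n k≤n)
      (sum-⊆ (filter⁺ (_≤? k) (_≤? k) (λ { refl x≤k → x≤k }) S⊆))

  module _ (practical : Practical n) where

    -- Each candidate k + 1 ≤ n exceeds the sum of the divisors up to k by at
    -- most one, because k is a sum of distinct divisors, all at most k.
    below-gap : ∀ k → suc k ≤ n → suc k ≤ suc (sum (below k))
    below-gap zero _ = s≤s z≤n
    below-gap (suc k) k<n with practical (suc k) (s≤s z≤n) k<n
    ... | S , S⊆ , sS = s≤s (subst (_≤ sum (below (suc k))) sS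
            (small-sublist-sum (<⇒≤ k<n) S⊆ (All.tabulate (λ x∈ → subst (_ ≤_) sS (∈⇒≤sum x∈)))))

    below-complete : ∀ k → k ≤ n → Complete (below k)
    below-complete zero _ = complete-[]
    below-complete (suc k) k<n = subst Complete (sym (below-suc k)) (extend (suc k ∣? n))
      where
      previous : Complete (below k)
      previous = below-complete k (<⇒≤ k<n)
      extend : Dec (suc k ∣ n) → Complete (below k ++ filter (_∣? n) [ suc k ])
      extend (yes k+1∣n) rewrite List.filter-accept (_∣? n) {xs = []} k+1∣n =
        complete-snoc previous (below-gap k k<n)
      extend (no k+1∤n) rewrite List.filter-reject (_∣? n) {xs = []} k+1∤n | List.++-identityʳ (below k) =
        previous

    practical-complete : Complete (divisors n)
    practical-complete = below-complete n ≤-refl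

    -- A practical number n > 1 is even: otherwise 2 < n would be a sum of
    -- distinct divisors that are all at most 2, hence all equal to 1.
    practical-even : 1 < n → 2 ∣ n
    practical-even 1<n with 2 ∣? n
    ... | yes 2∣n = 2∣n
    ... | no 2∤n with practical 2 (s≤s z≤n) 2<n
      where
      2<n : 2 < n
      2<n = ≤∧≢⇒< 1<n (λ { refl → 2∤n ∣-refl })
    ...   | S , S⊆ , sS = ⊥-elim (<⇒≱ (s≤s (s≤s z≤n)) (begin
      2                  ≡⟨ sS ⟨
      sum S              ≤⟨ small-sublist-sum (<⇒≤ 1<n) S⊆ (All.tabulate at-most-1) ⟩
      sum (below 1)      ≤⟨ sum-⊆ (filter-⊆ (_∣? n) [ 1 ]) ⟩
      1                  ∎))
      where
      open ≤-Reasoning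
      at-most-1 : ∀ {x} → x ∈ S → x ≤ 1
      at-most-1 {x} x∈S = ≤-pred (≤∧≢⇒< (subst (x ≤_) sS (∈⇒≤sum x∈S))
        (λ { refl → 2∤n (∈-divisors⁻ (lookup S⊆ x∈S)) }))

*-swap : ∀ a b c → a * (b * c) ≡ b * (a * c)
*-swap = solve-∀

prime-power-cancel : ∀ {p x m} i → Prime p → ¬ p ∣ x → x ∣ m * p ^ i → x ∣ m
prime-power-cancel {p} {x} {m} zero _ _ x∣m*1 = subst (x ∣_) (*-identityʳ m) x∣m*1
prime-power-cancel {p} {x} {m} (suc i) p-prime p∤x x∣ =
  prime-power-cancel i p-prime p∤x (coprime-divisor x⊥p (subst (x ∣_) (*-swap m p (p ^ i)) x∣))
  where
  x⊥p : Coprime x p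
  x⊥p (d∣x , d∣p) with prime⇒irreducible p-prime d∣p
  ... | inj₁ d≡1 = d≡1
  ... | inj₂ refl = ⊥-elim (p∤x d∣x)

geometric : ℕ → ℕ → ℕ
geometric p zero = 1
geometric p (suc i) = 1 + p * geometric p i

-- For even exponents the geometric sum 1 + p + ... + p^(2k) is odd: for
-- even p all terms but 1 are even, for odd p the terms pair up as
-- p^j(1 + p), which is even.
geometric-odd : ∀ p k → ∃[ a ] geometric p (k * 2) ≡ suc (a * 2)
geometric-odd p zero = 0 , refl
geometric-odd p (suc k) with geometric-odd p k | parity p
... | _ | inj₁ (b , refl) =
  b * (1 + b * 2 * geometric p (k * 2)) , even-base b (1 + b * 2 * geometric p (k * 2))
  where
  even-base : ∀ b x → 1 + b * 2 * x ≡ suc (b * x * 2)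
  even-base = solve-∀
... | a , g≡ | inj₂ (b , refl) =
  suc (b * 2) * suc b + suc (b * 2) * suc (b * 2) * a ,
  trans (cong (λ g → 1 + suc (b * 2) * (1 + suc (b * 2) * g)) g≡) (odd-base b a)
  where
  odd-base : ∀ b a → 1 + suc (b * 2) * (1 + suc (b * 2) * suc (a * 2))
    ≡ suc ((suc (b * 2) * suc b + suc (b * 2) * suc (b * 2) * a) * 2)
  odd-base = solve-∀

p-free : ℕ → List ℕ → List ℕ
p-free p = filter (¬? ∘ (p ∣?_))

sum-p-free : ∀ p X → ∃[ c ] sum X ≡ sum (p-free p X) + c * p
sum-p-free p [] = 0 , refl
sum-p-free p (x ∷ X) with sum-p-free p X | p ∣? x
... | c , eq | yes (divides d refl) =
  d + c , trans (cong (d * p +_) eq) (regroup d p (sum (p-free p X)) c)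
  where
  regroup : ∀ d p f c → d * p + (f + c * p) ≡ f + (d + c) * p
  regroup = solve-∀
... | c , eq | no p∤x =
  c , trans (cong (x +_) eq) (sym (+-assoc x (sum (p-free p X)) (c * p)))

mod-unique : ∀ {x y a b p} .{{_ : NonZero p}} → x < p → y < p → x + a * p ≡ y + b * p → x ≡ y
mod-unique {x} {y} {a} {b} {p} x<p y<p eq = begin
  x                ≡⟨ m<n⇒m%n≡m x<p ⟨
  x % p            ≡⟨ [m+kn]%n≡m%n x a p ⟨
  (x + a * p) % p  ≡⟨ cong (_% p) eq ⟩
  (y + b * p) % p  ≡⟨ [m+kn]%n≡m%n y b p ⟩
  y % p            ≡⟨ m<n⇒m%n≡m y<p ⟩
  y                ∎
  where open ≡-Reasoning

p-free-balance : ∀ p .{{_ : NonZero p}} A B → sum A ≡ sum B →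
  sum (p-free p A) < p → sum (p-free p B) < p → sum (p-free p A) ≡ sum (p-free p B)
p-free-balance p A B sA≡sB A<p B<p with sum-p-free p A | sum-p-free p B
... | a , sA≡ | b , sB≡ = mod-unique {a = a} {b = b} A<p B<p (trans (sym sA≡) (trans sA≡sB sB≡))

odd-split : ∀ {p s} q r → p ≡ suc (q * 2) → s ≡ suc (r * 2) → p ≤ s →
  ∃[ s₁ ] ∃[ s₂ ] (s₁ ≤ s × s₂ ≤ s × (s₁ + p * s₂) * 2 ≡ s * geometric p 1)
odd-split q r refl refl p≤s with m≤n⇒∃[o]m+o≡n (*-cancelʳ-≤ q r 2 (≤-pred p≤s))
... | s₁ , refl = s₁ , suc (q + s₁) , s₁≤ , s≤s (m≤m*n (q + s₁) 2) , balance q s₁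
  where
  s₁≤ : s₁ ≤ suc ((q + s₁) * 2)
  s₁≤ = ≤-trans (m≤n+m s₁ q) (≤-trans (m≤m*n (q + s₁) 2) (n≤1+n _))
  balance : ∀ q s₁ → (s₁ + suc (q * 2) * suc (q + s₁)) * 2 ≡ suc ((q + s₁) * 2) * (1 + suc (q * 2) * 1)
  balance = solve-∀

module Layers (n p : ℕ) (n>0 : 0 < n) (p-prime : Prime p) (p∤n : ¬ p ∣ n) where

  instance
    p≢0 : NonZero p
    p≢0 = prime⇒nonZero p-prime

  layers : ℕ → List ℕ
  layers zero = divisors n
  layers (suc i) = divisors n ++ map (p *_) (layers i)

  -- Entries of layers i divide n·p^i, and conversely every divisor of n·p^i
  -- occurs: a multiple of p comes from the level above, anything else divides n.
  layers⇒divisor : ∀ i {x} → x ∈ layers i → x ∣ n * p ^ i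
  layers⇒divisor zero {x} x∈ = subst (x ∣_) (sym (*-identityʳ n)) (∈-divisors⁻ x∈)
  layers⇒divisor (suc i) x∈ with ∈-++⁻ (divisors n) x∈
  ... | inj₁ x∈D = ∣m⇒∣m*n (p ^ suc i) (∈-divisors⁻ {n} x∈D)
  ... | inj₂ x∈pL with ∈-map⁻ (p *_) x∈pL
  ...   | y , y∈ , refl = subst (p * y ∣_) (*-swap p n (p ^ i)) (*-monoʳ-∣ p (layers⇒divisor i y∈))

  divisor⇒layers : ∀ i {x} → x ∣ n * p ^ i → x ∈ layers i
  divisor⇒layers zero {x} x∣ = ∈-divisors⁺ n>0 (subst (x ∣_) (*-identityʳ n) x∣)
  divisor⇒layers (suc i) {x} x∣ with p ∣? x
  ... | no p∤x = ∈-++⁺ˡ (∈-divisors⁺ n>0 (prime-power-cancel (suc i) p-prime p∤x x∣))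
  ... | yes (divides q refl) = ∈-++⁺ʳ (divisors n)
          (subst (_∈ map (p *_) (layers i)) (*-comm p q) (∈-map⁺ (p *_) (divisor⇒layers i q∣)))
    where
    q∣ : q ∣ n * p ^ i
    q∣ = *-cancelʳ-∣ p (subst (q * p ∣_) (trans (*-swap n p (p ^ i)) (*-comm p (n * p ^ i))) x∣)

  -- No entry repeats, since the entries of D are prime to p.
  layers-unique : ∀ i → Unique (layers i)
  layers-unique zero = divisors-unique n
  layers-unique (suc i) =
    Unique.++⁺ (divisors-unique n) (Unique.map⁺ (*-cancelˡ-≡ _ _ p) (layers-unique i)) disjoint
    where
    disjoint : ∀ {v} → ¬ (v ∈ divisors n × v ∈ map (p *_) (layers i))
    disjoint (v∈D , v∈pL) with ∈-map⁻ (p *_) v∈pL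
    ... | y , _ , refl = p∤n (∣-trans (m∣m*n y) (∈-divisors⁻ v∈D))

  divisors-layers : ∀ i → divisors (n * p ^ i) ↭ layers i
  divisors-layers i = ∼bag⇒↭ (unique∧set⇒bag (divisors-unique (n * p ^ i)) (layers-unique i)
    (mk⇔ (divisor⇒layers i ∘ ∈-divisors⁻) (∈-divisors⁺ N>0 ∘ layers⇒divisor i)))
    where
    N>0 : 0 < n * p ^ i
    N>0 = >-nonZero⁻¹ (n * p ^ i) {{m*n≢0 n (p ^ i) {{>-nonZero n>0}} {{m^n≢0 p i}}}}

  sum-layers : ∀ i → sum (layers i) ≡ σ n * geometric p i
  sum-layers zero = sym (*-identityʳ (σ n))
  sum-layers (suc i) = begin
    sum (divisors n ++ map (p *_) (layers i))  ≡⟨ sum-++ (divisors n) _ ⟩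
    σ n + sum (map (p *_) (layers i))          ≡⟨ cong (σ n +_) (sum-scale p (layers i)) ⟩
    σ n + p * sum (layers i)                   ≡⟨ cong (λ s → σ n + p * s) (sum-layers i) ⟩
    σ n + p * (σ n * geometric p i)            ≡⟨ horner (σ n) p (geometric p i) ⟩
    σ n * geometric p (suc i)                  ∎
    where
    open ≡-Reasoning
    horner : ∀ s p g → s + p * (s * g) ≡ s * (1 + p * g)
    horner = solve-∀

  σ-layers : ∀ i → σ (n * p ^ i) ≡ σ n * geometric p i
  σ-layers i = trans (sum-↭ (divisors-layers i)) (sum-layers i)

  subsum-layers : ∀ {c t} i → Subsum (divisors n) c → Subsum (layers i) t →
    Subsum (layers (suc i)) (c + p * t)
  subsum-layers _ c-sub t-sub = subsum-++ c-sub (subsum-scale p t-sub)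

  zumkeller-from-layers : ∀ {t} i → Subsum (layers i) t → σ n * geometric p i ≡ t * 2 →
    Zumkeller (n * p ^ i)
  zumkeller-from-layers i t-sub half =
    zumkeller-from-half {n * p ^ i} (subsum-↭ (↭-sym (divisors-layers i)) t-sub) (trans (σ-layers i) half)

  p-free-layers : ∀ i → p-free p (layers i) ≡ divisors n
  p-free-layers zero = List.filter-all (¬? ∘ (p ∣?_)) (All.tabulate coprime-entry)
    where
    coprime-entry : ∀ {x} → x ∈ divisors n → ¬ p ∣ x
    coprime-entry x∈ p∣x = p∤n (∣-trans p∣x (∈-divisors⁻ x∈))
  p-free-layers (suc i) = begin
    p-free p (divisors n ++ map (p *_) (layers i))
      ≡⟨ List.filter-++ (¬? ∘ (p ∣?_)) (divisors n) _ ⟩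
    p-free p (divisors n) ++ p-free p (map (p *_) (layers i))
      ≡⟨ cong₂ _++_ (p-free-layers zero) (List.filter-none (¬? ∘ (p ∣?_)) (All.tabulate multiple)) ⟩
    divisors n ++ []
      ≡⟨ List.++-identityʳ (divisors n) ⟩
    divisors n ∎
    where
    open ≡-Reasoning
    multiple : ∀ {x} → x ∈ map (p *_) (layers i) → ¬ ¬ p ∣ x
    multiple x∈ p∤x with ∈-map⁻ (p *_) x∈
    ... | y , _ , refl = p∤x (m∣m*n y)

  -- Part (ii), necessity of odd l: σ(n·p^l) = σ(n)·(1 + ... + p^l) is even,
  -- while both factors are odd when σ(n) is odd and l is even.
  zumkeller⇒odd-exponent : ∀ l → ¬ 2 ∣ σ n → Zumkeller (n * p ^ l) → ¬ 2 ∣ l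
  zumkeller⇒odd-exponent l σ-odd zumkeller (divides k refl)
    with euclidsLemma (σ n) (geometric p (k * 2)) prime[2]
           (subst (2 ∣_) (σ-layers (k * 2)) (zumkeller⇒σ-even {n * p ^ (k * 2)} zumkeller))
  ... | inj₁ 2∣σ = σ-odd 2∣σ
  ... | inj₂ 2∣g with geometric-odd p k
  ...   | a , g≡ = odd-suc-double a (subst (2 ∣_) g≡ 2∣g)

  -- Part (ii), necessity of p ≤ σ(n): otherwise the p-free parts of the two
  -- halves, which together are the divisors of n, agree modulo p and hence
  -- are equal, making σ(n) even.
  zumkeller⇒p≤σ : ∀ l → ¬ 2 ∣ σ n → Zumkeller (n * p ^ l) → p ≤ σ n
  zumkeller⇒p≤σ l σ-odd (A , B , AB↭ , sA≡sB) with p ≤? σ n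
  ... | yes p≤σ = p≤σ
  ... | no p≰σ = ⊥-elim (σ-odd (divides (sum (p-free p A)) σ-double))
    where
    open ≡-Reasoning
    free-total : sum (p-free p A) + sum (p-free p B) ≡ σ n
    free-total = begin
      sum (p-free p A) + sum (p-free p B)  ≡⟨ sum-++ (p-free p A) _ ⟨
      sum (p-free p A ++ p-free p B)       ≡⟨ cong sum (List.filter-++ (¬? ∘ (p ∣?_)) A B) ⟨
      sum (p-free p (A ++ B))              ≡⟨ sum-↭ (Perm.filter-↭ (¬? ∘ (p ∣?_)) (↭-trans AB↭ (divisors-layers l))) ⟩
      sum (p-free p (layers l))            ≡⟨ cong sum (p-free-layers l) ⟩
      σ n                                  ∎
    A<p : sum (p-free p A) < p
    A<p = ≤-<-trans (subst (_ ≤_) free-total (m≤m+n _ _)) (≰⇒> p≰σ)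
    B<p : sum (p-free p B) < p
    B<p = ≤-<-trans (subst (_ ≤_) free-total (m≤n+m _ _)) (≰⇒> p≰σ)
    σ-double : σ n ≡ sum (p-free p A) * 2
    σ-double = begin
      σ n                                  ≡⟨ free-total ⟨
      sum (p-free p A) + sum (p-free p B)  ≡⟨ cong (sum (p-free p A) +_) (p-free-balance p A B sA≡sB A<p B<p) ⟨
      sum (p-free p A) + sum (p-free p A)  ≡⟨ double (sum (p-free p A)) ⟩
      sum (p-free p A) * 2                 ∎

  -- Given subsums s₁, s₂ of the divisors of n with 2(s₁ + p·s₂) = σ(n)(1 + p),
  -- taking s₁ on even and s₂ on odd levels gives half of σ(n·p^l), l odd.
  module Alternating (s₁ s₂ : ℕ) (s₁-sub : Subsum (divisors n) s₁) (s₂-sub : Subsum (divisors n) s₂)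
                     (balance : (s₁ + p * s₂) * 2 ≡ σ n * geometric p 1) where

    alternating : ℕ → ℕ
    alternating zero = s₁ + p * s₂
    alternating (suc k) = s₁ + p * (s₂ + p * alternating k)

    alternating-sub : ∀ k → Subsum (layers (suc (k * 2))) (alternating k)
    alternating-sub zero = subsum-layers 0 s₁-sub s₂-sub
    alternating-sub (suc k) =
      subsum-layers (suc (suc (k * 2))) s₁-sub (subsum-layers (suc (k * 2)) s₂-sub (alternating-sub k))

    alternating-half : ∀ k → σ n * geometric p (suc (k * 2)) ≡ alternating k * 2
    alternating-half zero = sym balance
    alternating-half (suc k) = begin
      σ n * (1 + p * (1 + p * g))               ≡⟨ expand (σ n) p g ⟩
      σ n * (1 + p * 1) + p * p * (σ n * g)     ≡⟨ cong₂ (λ x y → x + p * p * y) balance (sym (alternating-half k)) ⟨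
      (s₁ + p * s₂) * 2 + p * p * (a * 2)       ≡⟨ collect s₁ s₂ p a ⟩
      (s₁ + p * (s₂ + p * a)) * 2               ∎
      where
      open ≡-Reasoning
      g : ℕ
      g = geometric p (suc (k * 2))
      a : ℕ
      a = alternating k
      expand : ∀ s p g → s * (1 + p * (1 + p * g)) ≡ s * (1 + p * 1) + p * p * (s * g)
      expand = solve-∀
      collect : ∀ s₁ s₂ p a → (s₁ + p * s₂) * 2 + p * p * (a * 2) ≡ (s₁ + p * (s₂ + p * a)) * 2
      collect = solve-∀

    alternating-zumkeller : ∀ k → Zumkeller (n * p ^ suc (k * 2))
    alternating-zumkeller k = zumkeller-from-layers (suc (k * 2)) (alternating-sub k) (alternating-half k)

  module _ (practical : Practical n) where

    complete : Complete (divisors n)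
    complete = DivisorsBelow.practical-complete n practical

    even-case : ∀ l → 2 ∣ σ n → Zumkeller (n * p ^ l)
    even-case l (divides h σ≡h*2) = zumkeller-from-layers l (constant l) half
      where
      h-sub : Subsum (divisors n) h
      h-sub = complete h (subst (h ≤_) (sym σ≡h*2) (m≤m*n h 2))
      horner : ∀ h p g → h + p * (h * g) ≡ h * (1 + p * g)
      horner = solve-∀
      constant : ∀ i → Subsum (layers i) (h * geometric p i)
      constant zero = subsum-≡ (sym (*-identityʳ h)) h-sub
      constant (suc i) = subsum-≡ (horner h p (geometric p i)) (subsum-layers i h-sub (constant i))
      reorder : ∀ h g → h * 2 * g ≡ h * g * 2
      reorder = solve-∀
      half : σ n * geometric p l ≡ h * geometric p l * 2
      half = trans (cong (_* geometric p l) σ≡h*2) (reorder h (geometric p l))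

    -- p ≤ σ(n) forces p odd: for p = 2 the number n would be odd, and n > 1
    -- since σ(n) ≥ 2, but practical numbers above 1 are even.
    p-odd : p ≤ σ n → ¬ 2 ∣ p
    p-odd p≤σ 2∣p with prime⇒irreducible p-prime 2∣p
    ... | inj₂ 2≡p with m≤n⇒m<n∨m≡n n>0
    ...   | inj₁ 1<n = p∤n (subst (_∣ n) 2≡p (DivisorsBelow.practical-even n practical 1<n))
    ...   | inj₂ 1≡n = <⇒≱ (s≤s (s≤s z≤n)) (subst₂ (λ q m → q ≤ σ m) (sym 2≡p) (sym 1≡n) p≤σ)

    odd-case : ∀ l → ¬ 2 ∣ σ n → p ≤ σ n → ¬ 2 ∣ l → Zumkeller (n * p ^ l)
    odd-case l σ-odd p≤σ l-odd with parity l | parity p | parity (σ n)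
    ... | inj₁ (k , l≡) | _ | _ = ⊥-elim (l-odd (divides k l≡))
    ... | _ | inj₁ (q , p≡) | _ = ⊥-elim (p-odd p≤σ (divides q p≡))
    ... | _ | _ | inj₁ (r , σ≡) = ⊥-elim (σ-odd (divides r σ≡))
    ... | inj₂ (k , refl) | inj₂ (q , p≡) | inj₂ (r , σ≡) with odd-split q r p≡ σ≡ p≤σ
    ...   | s₁ , s₂ , s₁≤σ , s₂≤σ , balance =
      Alternating.alternating-zumkeller s₁ s₂ (complete s₁ s₁≤σ) (complete s₂ s₂≤σ) balance k

coprime-prime-∤ : ∀ {n p} → Prime p → gcd n p ≡ 1 → ¬ p ∣ n
coprime-prime-∤ p-prime gcd≡1 p∣n =
  ¬prime[1] (subst Prime (gcd≡1⇒coprime gcd≡1 (p∣n , ∣-refl)) p-prime)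

mainTheorem1 : (n p l : ℕ) → 0 < n → Practical n → Prime p → gcd n p ≡ 1 → 0 < l →
    (Even (σ n) → Zumkeller (n * p ^ l)) ×
    (Odd (σ n) → (Zumkeller (n * p ^ l) ⇔ (p ≤ σ n × Odd l)))
mainTheorem1 n p l n>0 practical p-prime gcd≡1 _ =
  even-case practical l ,
  λ σ-odd → mk⇔ (λ zumkeller → zumkeller⇒p≤σ l σ-odd zumkeller , zumkeller⇒odd-exponent l σ-odd zumkeller)
                (λ (p≤σ , l-odd) → odd-case practical l σ-odd p≤σ l-odd)
  where open Layers n p n>0 p-prime (coprime-prime-∤ p-prime gcd≡1)
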